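{- Let $q$ be a prime power, let $f\colon\mathbb{F}_q^n\to\mathbb{F}_q$ be a function, and let $U$ be a linear subspace of $\mathbb{F}_q^n$ with basis vectors $\Delta_1,\dots,\Delta_k$. Then there exist polynomials $(f_\alpha)_{\alpha\in\{0,1,\dots,q-1\}^k}$ over $\mathbb{F}_q$ in $n$ variables such that: (1) $\deg(f_\alpha)\le\deg(f)-\mathrm{wt}(\alpha)$ for all $\alpha\in\{0,1,\dots,q-1\}^k$; (2) for every $x\in\mathbb{F}_q^n$, $f$ restricted to $x+U$ is identically $0$ if and only if $f_\alpha(x)=0$ for all $\alpha\in\{0,1,\dots,q-1\}^k$.
   Context: $\deg(f)$ is the total degree of the unique polynomial with individual degrees at most $q-1$ agreeing with $f$ on $\mathbb{F}_q^n$; a polynomial of negative degree bound is the zero polynomial. For $\alpha\in\mathbb{N}^k$, $\mathrm{wt}(\alpha)=\sum_i\alpha_i$. -}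

module Defs where

open import Level using (0ℓ)
open import Data.Nat using (ℕ; zero; suc) renaming (_+_ to _+ℕ_; _<_ to _<ℕ_; _^_ to _^ℕ_)
open import Data.Nat.Primality using (Prime)
open import Data.Fin using (Fin; toℕ) renaming (zero to fz; suc to fs)
open import Data.List using (List; []; _∷_; foldr; concatMap; map; allFin)
open import Data.Product using (Σ; _×_; _,_)
open import Relation.Nullary using (¬_)
open import Relation.Binary.PropositionalEquality using (_≡_)
open import Algebra.Bundles using (CommutativeRing)

IsPrimePower : ℕ → Set
IsPrimePower q = Σ ℕ λ p → Σ ℕ λ m → Prime p × q ≡ p ^ℕ suc m

-- A finite field with exactly q elements.  Its equality is propositional
-- (the setoid equality of the underlying ring coincides with _≡_).
record FiniteField (q : ℕ) : Set₁ where
  field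
    commRing : CommutativeRing 0ℓ 0ℓ
  open CommutativeRing commRing public
  field
    ≈⇒≡       : ∀ {x y} → x ≈ y → x ≡ y
    0≢1       : ¬ (0# ≡ 1#)
    inverse   : ∀ x → ¬ (x ≡ 0#) → Σ Carrier λ y → x * y ≡ 1#
    enum      : Fin q → Carrier
    enum-inj  : ∀ i j → enum i ≡ enum j → i ≡ j
    enum-surj : ∀ x → Σ (Fin q) λ i → enum i ≡ x

wt : ∀ {q k} → (Fin k → Fin q) → ℕ
wt {k = zero}  α = 0
wt {k = suc k} α = toℕ (α fz) +ℕ wt (λ i → α (fs i))

allIdx : (q n : ℕ) → List (Fin n → Fin q)
allIdx q zero    = (λ ()) ∷ []
allIdx q (suc n) =
  concatMap (λ a → map (λ e → λ { fz → a ; (fs i) → e i }) (allIdx q n)) (allFin q)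

module FF {q : ℕ} (F : FiniteField q) where
  open FiniteField F

  Point : ℕ → Set
  Point n = Fin n → Carrier

  ∑ : ∀ {k} → (Fin k → Carrier) → Carrier
  ∑ {zero}  g = 0#
  ∑ {suc k} g = g fz + ∑ (λ i → g (fs i))

  ∏ : ∀ {k} → (Fin k → Carrier) → Carrier
  ∏ {zero}  g = 1#
  ∏ {suc k} g = g fz * ∏ (λ i → g (fs i))

  pow : Carrier → ℕ → Carrier
  pow x zero    = 1#
  pow x (suc m) = x * pow x m

  _⊕_ : ∀ {n} → Point n → Point n → Point n
  (x ⊕ y) j = x j + y j

  lincomb : ∀ {k n} → (Fin k → Carrier) → (Fin k → Point n) → Point n
  lincomb t Δ j = ∑ (λ i → t i * Δ i j)

  LinearlyIndependent : ∀ {k n} → (Fin k → Point n) → Set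
  LinearlyIndependent Δ =
    ∀ t → (∀ j → lincomb t Δ j ≡ 0#) → ∀ i → t i ≡ 0#

  InSpan : ∀ {k n} → (Fin k → Point n) → Point n → Set
  InSpan Δ u = Σ (Fin _ → Carrier) λ t → ∀ j → u j ≡ lincomb t Δ j

  -- A polynomial over F_q in n variables with individual degrees ≤ q-1,
  -- given by its coefficient on each monomial x^e, e ∈ {0,…,q-1}^n.
  Poly : ℕ → Set
  Poly n = (Fin n → Fin q) → Carrier

  monomial : ∀ {n} → (Fin n → Fin q) → Point n → Carrier
  monomial e x = ∏ (λ j → pow (x j) (toℕ (e j)))

  eval : ∀ {n} → Poly n → Point n → Carrier
  eval {n} P x = foldr (λ e acc → P e * monomial e x + acc) 0# (allIdx q n)

  -- deg P ≤ d - w  (with d - w possibly negative: then P is the zero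
  -- polynomial).  Stated as: every monomial of total degree > d - w,
  -- i.e. with wt e + w > d, has zero coefficient.
  DegLeMinus : ∀ {n} → Poly n → ℕ → ℕ → Set
  DegLeMinus P d w = ∀ e → d <ℕ wt e +ℕ w → P e ≡ 0#

  DegLe : ∀ {n} → Poly n → ℕ → Set
  DegLe P d = DegLeMinus P d 0

-- Let P be the reduced polynomial of degree ≤ d representing f. Substituting x + Σᵢ tᵢΔᵢ into P and
-- expanding, with exponents reduced by y ^ q = y, gives a polynomial in (x, t) all of whose terms have
-- total degree ≤ d; grouping its terms by their t-monomial t^α yields f (x + Σᵢ tᵢΔᵢ) = Σ_α f_α(x) t^α
-- with deg f_α ≤ d - wt α. A reduced polynomial in t vanishing on all of F_q^k has zero coefficients
-- (a univariate polynomial of degree < q with q roots is zero; induct on the number of variables), so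
-- f vanishes on x + U exactly when all f_α(x) vanish.

module Submission where

open import Defs
open import Data.Nat using (ℕ)
open import Data.Fin using (Fin)
open import Data.Product using (Σ; _×_)
open import Function.Bundles using (_⇔_)
open import Relation.Binary.PropositionalEquality using (_≡_)

open import Data.Nat as ℕ using (zero; suc; _≤_; _<_; z≤n; s≤s) renaming (_+_ to _+ℕ_; _∸_ to _∸ℕ_)
import Data.Nat.Properties as ℕₚ
open import Data.Fin as Fin using (toℕ; fromℕ<) renaming (zero to fz; suc to fs)
import Data.Fin.Properties as Finₚ
open import Data.Fin.Permutation using (Permutation′; permutation; _⟨$⟩ʳ_)
open import Data.Vec.Functional using () renaming (_∷_ to _◂_)
open import Data.List using (List; []; _∷_; _++_; map; concatMap; allFin; tabulate; foldr)
open import Data.List.Relation.Unary.All as All using (All; []; _∷_)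
import Data.List.Relation.Unary.All.Properties as Allₚ
open import Data.Bool using (if_then_else_)
open import Data.Maybe using (nothing)
open import Data.Product using (_,_; proj₁; proj₂)
open import Function using (_∘_)
open import Function.Bundles using (mk⇔)
open import Relation.Nullary using (¬_; Dec; yes; no; does; contradiction)
open import Relation.Nullary.Decidable using (dec-true; dec-false)
open import Relation.Binary.Definitions using (DecidableEquality)
open import Relation.Binary.PropositionalEquality
  using (refl; sym; trans; cong; cong₂; subst; module ≡-Reasoning)
open import Algebra.Bundles using (CommutativeRing)
import Algebra.Properties.CommutativeMonoid.Sum as MonoidSumProperties
import Algebra.Properties.CommutativeSemigroup as CommutativeSemigroupProperties
import Algebra.Properties.Group as GroupProperties
open import Tactic.RingSolver using (solve-∀)
open import Tactic.RingSolver.Core.AlmostCommutativeRing using (AlmostCommutativeRing; fromCommutativeRing)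

private
  module ℕ-CS = CommutativeSemigroupProperties ℕₚ.+-commutativeSemigroup

module FieldFacts {q : ℕ} (F : FiniteField q) where
  open FiniteField F using (Carrier; _+_; _*_; _-_; 0#; 1#; ≈⇒≡; inverse; enum; enum-inj; enum-surj)
  open FF F
  private
    module R = FiniteField F
    module *-CS = CommutativeSemigroupProperties R.*-commutativeSemigroup
    module +-CS = CommutativeSemigroupProperties R.+-commutativeSemigroup
    module +-G = GroupProperties R.+-group
    module *-Sum = MonoidSumProperties R.*-commutativeMonoid

  +-identityˡ : ∀ a → 0# + a ≡ a
  +-identityˡ a = ≈⇒≡ (R.+-identityˡ a)

  +-identityʳ : ∀ a → a + 0# ≡ a
  +-identityʳ a = ≈⇒≡ (R.+-identityʳ a)

  *-identityˡ : ∀ a → 1# * a ≡ a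
  *-identityˡ a = ≈⇒≡ (R.*-identityˡ a)

  *-identityʳ : ∀ a → a * 1# ≡ a
  *-identityʳ a = ≈⇒≡ (R.*-identityʳ a)

  zeroˡ : ∀ a → 0# * a ≡ 0#
  zeroˡ a = ≈⇒≡ (R.zeroˡ a)

  zeroʳ : ∀ a → a * 0# ≡ 0#
  zeroʳ a = ≈⇒≡ (R.zeroʳ a)

  *-comm : ∀ a b → a * b ≡ b * a
  *-comm a b = ≈⇒≡ (R.*-comm a b)

  +-assoc : ∀ a b c → (a + b) + c ≡ a + (b + c)
  +-assoc a b c = ≈⇒≡ (R.+-assoc a b c)

  *-assoc : ∀ a b c → (a * b) * c ≡ a * (b * c)
  *-assoc a b c = ≈⇒≡ (R.*-assoc a b c)

  distribˡ : ∀ a b c → a * (b + c) ≡ a * b + a * c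
  distribˡ a b c = ≈⇒≡ (R.distribˡ a b c)

  +-interchange : ∀ a b c d → (a + b) + (c + d) ≡ (a + c) + (b + d)
  +-interchange a b c d = ≈⇒≡ (+-CS.interchange a b c d)

  *-interchange : ∀ a b c d → (a * b) * (c * d) ≡ (a * c) * (b * d)
  *-interchange a b c d = ≈⇒≡ (*-CS.interchange a b c d)

  x*yz≡y*xz : ∀ a b c → a * (b * c) ≡ b * (a * c)
  x*yz≡y*xz a b c = ≈⇒≡ (*-CS.x∙yz≈y∙xz a b c)

  x-y+y≡x : ∀ a b → (a - b) + b ≡ a
  x-y+y≡x a b = ≈⇒≡ (+-G.//-rightDividesˡ b a)

  x-y≡0⇒x≡y : ∀ {a b} → a - b ≡ 0# → a ≡ b
  x-y≡0⇒x≡y {a} {b} a-b≡0 = ≈⇒≡ (+-G.x∙y⁻¹≈ε⇒x≈y a b (R.reflexive a-b≡0))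

  xy≡0⇒y≡0 : ∀ {x y} → ¬ x ≡ 0# → x * y ≡ 0# → y ≡ 0#
  xy≡0⇒y≡0 {x} {y} x≢0 xy≡0 with inverse x x≢0
  ... | x⁻¹ , xx⁻¹≡1 = begin
    y              ≡⟨ sym (*-identityˡ y) ⟩
    1# * y         ≡⟨ cong (_* y) (trans (sym xx⁻¹≡1) (*-comm x x⁻¹)) ⟩
    (x⁻¹ * x) * y  ≡⟨ *-assoc x⁻¹ x y ⟩
    x⁻¹ * (x * y)  ≡⟨ cong (x⁻¹ *_) xy≡0 ⟩
    x⁻¹ * 0#       ≡⟨ zeroʳ x⁻¹ ⟩
    0#             ∎
    where open ≡-Reasoning

  index : Carrier → Fin q
  index z = proj₁ (enum-surj z)

  enum-index : ∀ z → enum (index z) ≡ z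
  enum-index z = proj₂ (enum-surj z)

  index-enum : ∀ i → index (enum i) ≡ i
  index-enum i = enum-inj _ _ (enum-index (enum i))

  _≟_ : DecidableEquality Carrier
  a ≟ b with index a Fin.≟ index b
  ... | yes eq  = yes (trans (sym (enum-index a)) (trans (cong enum eq) (enum-index b)))
  ... | no  neq = no (neq ∘ cong index)

  pow-+ : ∀ y a b → pow y (a +ℕ b) ≡ pow y a * pow y b
  pow-+ y zero    b = sym (*-identityˡ _)
  pow-+ y (suc a) b = trans (cong (y *_) (pow-+ y a b)) (sym (*-assoc y _ _))

  ∑-cong : ∀ {m} {g h : Fin m → Carrier} → (∀ i → g i ≡ h i) → ∑ g ≡ ∑ h
  ∑-cong {zero}  g≗h = refl
  ∑-cong {suc m} g≗h = cong₂ _+_ (g≗h fz) (∑-cong (g≗h ∘ fs))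

  ∑-zero : ∀ {m} {g : Fin m → Carrier} → (∀ i → g i ≡ 0#) → ∑ g ≡ 0#
  ∑-zero {zero}  g≗0 = refl
  ∑-zero {suc m} g≗0 = trans (cong₂ _+_ (g≗0 fz) (∑-zero (g≗0 ∘ fs))) (+-identityˡ 0#)

  *-distribˡ-∑ : ∀ {m} c (g : Fin m → Carrier) → c * ∑ g ≡ ∑ (λ i → c * g i)
  *-distribˡ-∑ {zero}  c g = zeroʳ c
  *-distribˡ-∑ {suc m} c g = trans (distribˡ c _ _) (cong (c * g fz +_) (*-distribˡ-∑ c (g ∘ fs)))

  ∏-cong : ∀ {m} {g h : Fin m → Carrier} → (∀ i → g i ≡ h i) → ∏ g ≡ ∏ h
  ∏-cong {zero}  g≗h = refl
  ∏-cong {suc m} g≗h = cong₂ _*_ (g≗h fz) (∏-cong (g≗h ∘ fs))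

  ∏-distrib-* : ∀ {m} (g h : Fin m → Carrier) → ∏ (λ i → g i * h i) ≡ ∏ g * ∏ h
  ∏-distrib-* {zero}  g h = sym (*-identityˡ 1#)
  ∏-distrib-* {suc m} g h =
    trans (cong (g fz * h fz *_) (∏-distrib-* (g ∘ fs) (h ∘ fs))) (*-interchange _ _ _ _)

  ∏-const : ∀ m y → ∏ {m} (λ _ → y) ≡ pow y m
  ∏-const zero    y = refl
  ∏-const (suc m) y = cong (y *_) (∏-const m y)

  ∏-1 : ∀ m → ∏ {m} (λ _ → 1#) ≡ 1#
  ∏-1 zero    = refl
  ∏-1 (suc m) = trans (*-identityˡ _) (∏-1 m)

  ∏-const-except : ∀ {m} (g : Fin (suc m) → Carrier) y i₀ →
    g i₀ ≡ 1# → (∀ i → ¬ i ≡ i₀ → g i ≡ y) → ∏ g ≡ pow y m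
  ∏-const-except {m} g y fz g₀≡1 g≡y =
    trans (cong₂ _*_ g₀≡1 (∏-cong (λ i → g≡y (fs i) λ ()))) (trans (*-identityˡ _) (∏-const m y))
  ∏-const-except {suc m} g y (fs i₀) g₀≡1 g≡y =
    cong₂ _*_ (g≡y fz λ ())
      (∏-const-except (g ∘ fs) y i₀ g₀≡1 (λ i i≢i₀ → g≡y (fs i) (i≢i₀ ∘ Finₚ.suc-injective)))

  ∏-invertible : ∀ {m} (g : Fin m → Carrier) → (∀ i → ¬ g i ≡ 0#) → Σ Carrier λ b → ∏ g * b ≡ 1#
  ∏-invertible {zero}  g g≢0 = 1# , *-identityˡ 1#
  ∏-invertible {suc m} g g≢0 with inverse (g fz) (g≢0 fz) | ∏-invertible (g ∘ fs) (g≢0 ∘ fs)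
  ... | a , ga≡1 | b , gb≡1 =
    a * b , trans (*-interchange _ _ a b) (trans (cong₂ _*_ ga≡1 gb≡1) (*-identityˡ 1#))

  ∏-permute : ∀ {m} (g : Fin m → Carrier) (π : Permutation′ m) → ∏ g ≡ ∏ (g ∘ (π ⟨$⟩ʳ_))
  ∏-permute g π = trans (∏≡sum g) (trans (≈⇒≡ (*-Sum.sum-permute g π)) (sym (∏≡sum (g ∘ (π ⟨$⟩ʳ_)))))
    where
    ∏≡sum : ∀ {m} (g : Fin m → Carrier) → ∏ g ≡ *-Sum.sum g
    ∏≡sum {zero}  g = refl
    ∏≡sum {suc m} g = cong (g fz *_) (∏≡sum (g ∘ fs))

module ListSums {q : ℕ} (F : FiniteField q) where
  open FiniteField F using (Carrier; _+_; _*_; 0#)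
  open FF F
  open FieldFacts F

  -- eval P x unfolds definitionally to ∑ᴸ (allIdx q n) (λ e → P e * monomial e x).
  ∑ᴸ : ∀ {A : Set} → List A → (A → Carrier) → Carrier
  ∑ᴸ L h = foldr (λ a s → h a + s) 0# L

  module _ {A : Set} where

    ∑ᴸ-cong : ∀ (L : List A) {g h : A → Carrier} → (∀ a → g a ≡ h a) → ∑ᴸ L g ≡ ∑ᴸ L h
    ∑ᴸ-cong []      g≗h = refl
    ∑ᴸ-cong (a ∷ L) g≗h = cong₂ _+_ (g≗h a) (∑ᴸ-cong L g≗h)

    ∑ᴸ-zero : ∀ {L : List A} {h : A → Carrier} → All (λ a → h a ≡ 0#) L → ∑ᴸ L h ≡ 0#
    ∑ᴸ-zero []             = refl
    ∑ᴸ-zero (ha≡0 ∷ hL≡0) = trans (cong₂ _+_ ha≡0 (∑ᴸ-zero hL≡0)) (+-identityˡ 0#)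

    ∑ᴸ-++ : ∀ (L L′ : List A) h → ∑ᴸ (L ++ L′) h ≡ ∑ᴸ L h + ∑ᴸ L′ h
    ∑ᴸ-++ []      L′ h = sym (+-identityˡ _)
    ∑ᴸ-++ (a ∷ L) L′ h = trans (cong (h a +_) (∑ᴸ-++ L L′ h)) (sym (+-assoc _ _ _))

    ∑ᴸ-distrib-+ : ∀ (L : List A) g h → ∑ᴸ L (λ a → g a + h a) ≡ ∑ᴸ L g + ∑ᴸ L h
    ∑ᴸ-distrib-+ []      g h = sym (+-identityˡ 0#)
    ∑ᴸ-distrib-+ (a ∷ L) g h = trans (cong (g a + h a +_) (∑ᴸ-distrib-+ L g h)) (+-interchange _ _ _ _)

    *-distribˡ-∑ᴸ : ∀ (L : List A) c h → c * ∑ᴸ L h ≡ ∑ᴸ L (λ a → c * h a)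
    *-distribˡ-∑ᴸ []      c h = zeroʳ c
    *-distribˡ-∑ᴸ (a ∷ L) c h = trans (distribˡ c _ _) (cong (c * h a +_) (*-distribˡ-∑ᴸ L c h))

    *-distribʳ-∑ᴸ : ∀ (L : List A) c h → ∑ᴸ L h * c ≡ ∑ᴸ L (λ a → h a * c)
    *-distribʳ-∑ᴸ L c h = trans (*-comm _ c) (trans (*-distribˡ-∑ᴸ L c h) (∑ᴸ-cong L (λ a → *-comm c (h a))))

  ∑ᴸ-map : ∀ {A B : Set} (g : A → B) (L : List A) h → ∑ᴸ (map g L) h ≡ ∑ᴸ L (h ∘ g)
  ∑ᴸ-map g []      h = refl
  ∑ᴸ-map g (a ∷ L) h = cong (h (g a) +_) (∑ᴸ-map g L h)

  ∑ᴸ-concatMap : ∀ {A B : Set} (g : A → List B) (L : List A) h →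
    ∑ᴸ (concatMap g L) h ≡ ∑ᴸ L (λ a → ∑ᴸ (g a) h)
  ∑ᴸ-concatMap g []      h = refl
  ∑ᴸ-concatMap g (a ∷ L) h = trans (∑ᴸ-++ (g a) (concatMap g L) h) (cong (∑ᴸ (g a) h +_) (∑ᴸ-concatMap g L h))

  ∑ᴸ-comm : ∀ {A B : Set} (L : List A) (L′ : List B) (g : A → B → Carrier) →
    ∑ᴸ L (λ a → ∑ᴸ L′ (g a)) ≡ ∑ᴸ L′ (λ b → ∑ᴸ L (λ a → g a b))
  ∑ᴸ-comm []      L′ g = sym (∑ᴸ-zero (All.universal (λ _ → refl) L′))
  ∑ᴸ-comm (a ∷ L) L′ g =
    trans (cong (∑ᴸ L′ (g a) +_) (∑ᴸ-comm L L′ g))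
      (sym (∑ᴸ-distrib-+ L′ (g a) (λ b → ∑ᴸ L (λ a′ → g a′ b))))

  ∑ᴸ-tabulate : ∀ {A : Set} {m} (f : Fin m → A) h → ∑ᴸ (tabulate f) h ≡ ∑ (h ∘ f)
  ∑ᴸ-tabulate {m = zero}  f h = refl
  ∑ᴸ-tabulate {m = suc m} f h = cong (h (f fz) +_) (∑ᴸ-tabulate (f ∘ fs) h)

module Sifting {q : ℕ} (F : FiniteField q) where
  open FiniteField F using (Carrier; _+_; _*_; 0#)
  open FF F
  open FieldFacts F
  open ListSums F

  when : ∀ {P : Set} → Dec P → Carrier → Carrier
  when (yes _) c = c
  when (no _)  _ = 0#

  module _ {P : Set} where

    when-yes : ∀ (p? : Dec P) → P → ∀ c → when p? c ≡ c
    when-yes (yes _) _ c = refl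
    when-yes (no ¬p) p c = contradiction p ¬p

    when-⇔ : ∀ {Q : Set} (p? : Dec P) (q? : Dec Q) → (P → Q) → (Q → P) → ∀ c → when p? c ≡ when q? c
    when-⇔ (yes _) (yes _) _   _   c = refl
    when-⇔ (yes p) (no ¬q) P→Q _   c = contradiction (P→Q p) ¬q
    when-⇔ (no ¬p) (yes q) _   Q→P c = contradiction (Q→P q) ¬p
    when-⇔ (no _)  (no _)  _   _   c = refl

    when-× : ∀ {A B : Set} (p? : Dec P) (a? : Dec A) (b? : Dec B) →
      (P → A) → (P → B) → (A → B → P) → ∀ c → when p? c ≡ when a? (when b? c)
    when-× (yes _) (yes _) (yes _) _   _   _    c = refl
    when-× (yes p) (yes _) (no ¬b) _   P→B _    c = contradiction (P→B p) ¬b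
    when-× (yes p) (no ¬a) _       P→A _   _    c = contradiction (P→A p) ¬a
    when-× (no ¬p) (yes a) (yes b) _   _   A→B→P c = contradiction (A→B→P a b) ¬p
    when-× (no _)  (yes _) (no _)  _   _   _    c = refl
    when-× (no _)  (no _)  _       _   _   _    c = refl

    when-*ʳ : ∀ (p? : Dec P) c u → when p? c * u ≡ when p? (c * u)
    when-*ʳ (yes _) c u = refl
    when-*ʳ (no _)  c u = zeroˡ u

    ∑ᴸ-when : ∀ {A : Set} (p? : Dec P) (L : List A) h → ∑ᴸ L (λ a → when p? (h a)) ≡ when p? (∑ᴸ L h)
    ∑ᴸ-when (yes _) L h = refl
    ∑ᴸ-when (no _)  L h = ∑ᴸ-zero (All.universal (λ _ → refl) L)

  ∑-when-≟ : ∀ {m} (j : Fin m) (g : Fin m → Carrier) → ∑ (λ a → when (j Fin.≟ a) (g a)) ≡ g j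
  ∑-when-≟ {suc m} fz     g = trans (cong (g fz +_) (∑-zero {m} (λ _ → refl))) (+-identityʳ (g fz))
  ∑-when-≟         (fs j) g = trans (+-identityˡ _) (trans
    (∑-cong (λ a → when-⇔ (fs j Fin.≟ fs a) (j Fin.≟ a) Finₚ.suc-injective (cong fs) (g (fs a))))
    (∑-when-≟ j (g ∘ fs)))

  _≐_ : ∀ {m} → (Fin m → Fin q) → (Fin m → Fin q) → Set
  e ≐ e′ = ∀ i → e i ≡ e′ i

  _≐?_ : ∀ {m} (e e′ : Fin m → Fin q) → Dec (e ≐ e′)
  e ≐? e′ = Finₚ.all? (λ i → e i Fin.≟ e′ i)

  -- allIdx builds exponent vectors as pattern-matching lambdas, equal to a ◂ e only pointwise; lacking
  -- function extensionality, functions of exponent vectors must be shown to respect ≐.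
  Extensional : ∀ {m} → ((Fin m → Fin q) → Carrier) → Set
  Extensional g = ∀ {e e′} → e ≐ e′ → g e ≡ g e′

  when-≐ : ∀ {m} (e₀ : Fin m → Fin q) {e e′} → e ≐ e′ → ∀ c → when (e₀ ≐? e) c ≡ when (e₀ ≐? e′) c
  when-≐ e₀ e≐e′ =
    when-⇔ (e₀ ≐? _) (e₀ ≐? _) (λ p i → trans (p i) (e≐e′ i)) (λ p i → trans (p i) (sym (e≐e′ i)))

  ∑ᴸ-allIdx-◂ : ∀ n (h : (Fin (suc n) → Fin q) → Carrier) → Extensional h →
    ∑ᴸ (allIdx q (suc n)) h ≡ ∑ (λ a → ∑ᴸ (allIdx q n) (λ e → h (a ◂ e)))
  ∑ᴸ-allIdx-◂ n h h-ext = begin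
    ∑ᴸ (allIdx q (suc n)) h
      ≡⟨ ∑ᴸ-concatMap _ (allFin q) h ⟩
    ∑ᴸ (allFin q) (λ a → ∑ᴸ (map _ (allIdx q n)) h)
      ≡⟨ ∑ᴸ-cong (allFin q) (λ a → trans (∑ᴸ-map _ (allIdx q n) h)
           (∑ᴸ-cong (allIdx q n) (λ e → h-ext (λ { fz → refl ; (fs i) → refl })))) ⟩
    ∑ᴸ (allFin q) (λ a → ∑ᴸ (allIdx q n) (λ e → h (a ◂ e)))
      ≡⟨ ∑ᴸ-tabulate {m = q} (λ a → a) _ ⟩
    ∑ (λ a → ∑ᴸ (allIdx q n) (λ e → h (a ◂ e))) ∎
    where open ≡-Reasoning

  ∑ᴸ-allIdx-when-≐ : ∀ n (e₀ : Fin n → Fin q) (g : (Fin n → Fin q) → Carrier) → Extensional g →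
    ∑ᴸ (allIdx q n) (λ e → when (e₀ ≐? e) (g e)) ≡ g e₀
  ∑ᴸ-allIdx-when-≐ zero e₀ g g-ext = only _
    where
    only : ∀ e → when (e₀ ≐? e) (g e) + 0# ≡ g e₀
    only e = trans (+-identityʳ _) (trans (when-yes (e₀ ≐? e) (λ ()) (g e)) (g-ext (λ ())))
  ∑ᴸ-allIdx-when-≐ (suc n) e₀ g g-ext = begin
    ∑ᴸ (allIdx q (suc n)) (λ e → when (e₀ ≐? e) (g e))
      ≡⟨ ∑ᴸ-allIdx-◂ n _ (λ e≐e′ → trans (when-≐ e₀ e≐e′ _) (cong (when (e₀ ≐? _)) (g-ext e≐e′))) ⟩
    ∑ (λ a → ∑ᴸ (allIdx q n) (λ e → when (e₀ ≐? (a ◂ e)) (g (a ◂ e))))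
      ≡⟨ ∑-cong (λ a → ∑ᴸ-cong (allIdx q n) (λ e →
           when-× (e₀ ≐? (a ◂ e)) (e₀ fz Fin.≟ a) ((e₀ ∘ fs) ≐? e) (λ p → p fz) (λ p i → p (fs i))
             (λ { p p′ fz → p ; p p′ (fs i) → p′ i }) _)) ⟩
    ∑ (λ a → ∑ᴸ (allIdx q n) (λ e → when (e₀ fz Fin.≟ a) (when ((e₀ ∘ fs) ≐? e) (g (a ◂ e)))))
      ≡⟨ ∑-cong (λ a → ∑ᴸ-when (e₀ fz Fin.≟ a) (allIdx q n) _) ⟩
    ∑ (λ a → when (e₀ fz Fin.≟ a) (∑ᴸ (allIdx q n) (λ e → when ((e₀ ∘ fs) ≐? e) (g (a ◂ e)))))
      ≡⟨ ∑-cong (λ a → cong (when (e₀ fz Fin.≟ a))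
           (∑ᴸ-allIdx-when-≐ n (e₀ ∘ fs) (g ∘ (a ◂_))
             (λ e≐e′ → g-ext (λ { fz → refl ; (fs i) → e≐e′ i })))) ⟩
    ∑ (λ a → when (e₀ fz Fin.≟ a) (g (a ◂ (e₀ ∘ fs))))
      ≡⟨ ∑-when-≟ (e₀ fz) _ ⟩
    g (e₀ fz ◂ (e₀ ∘ fs))
      ≡⟨ g-ext (λ { fz → refl ; (fs i) → refl }) ⟩
    g e₀ ∎
    where open ≡-Reasoning

  ∑ᴸ-allIdx-collect : ∀ {A : Set} {n} (L : List A) (κ : A → Fin n → Fin q)
    (g : A → (Fin n → Fin q) → Carrier) → (∀ a → Extensional (g a)) →
    ∑ᴸ (allIdx q n) (λ e → ∑ᴸ L (λ a → when (κ a ≐? e) (g a e))) ≡ ∑ᴸ L (λ a → g a (κ a))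
  ∑ᴸ-allIdx-collect {n = n} L κ g g-ext = trans (∑ᴸ-comm (allIdx q n) L _)
    (∑ᴸ-cong L (λ a → ∑ᴸ-allIdx-when-≐ n (κ a) (g a) (g-ext a)))

module _ {c ℓ} (R : CommutativeRing c ℓ) where
  private
    -- The zero test never succeeds, so the solver proves only identities needing no cancellation.
    ring≈ : AlmostCommutativeRing c ℓ
    ring≈ = fromCommutativeRing R (λ _ → nothing)
  open AlmostCommutativeRing ring≈ using (_≈_; _+_; _*_)

  division-step : ∀ b σ ρ u v → b + (σ + ρ) * (σ * u + v) ≈ σ * (v + (σ + ρ) * u) + (b + ρ * v)
  division-step = solve-∀ ring≈

module ReducedPolynomials {q : ℕ} (F : FiniteField q) where
  open FiniteField F using (Carrier; _+_; _*_; _-_; 0#; 1#; ≈⇒≡; commRing; enum; enum-inj)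
  open FF F
  open FieldFacts F
  open ListSums F
  open Sifting F

  monomial-≐ : ∀ {m} {e e′ : Fin m → Fin q} (x : Point m) → e ≐ e′ → monomial e x ≡ monomial e′ x
  monomial-≐ x e≐e′ = ∏-cong (λ j → cong (λ a → pow (x j) (toℕ a)) (e≐e′ j))

  eval-pointwise : ∀ {n} (P : Poly n) {x y : Point n} → (∀ j → x j ≡ y j) → eval P x ≡ eval P y
  eval-pointwise {n} P x≗y =
    ∑ᴸ-cong (allIdx q n) (λ e → cong (P e *_) (∏-cong (λ j → cong (λ z → pow z (toℕ (e j))) (x≗y j))))

  horner : ∀ {m} → (Fin m → Carrier) → Carrier → Carrier
  horner {zero}  b s = 0#
  horner {suc m} b s = b fz + s * horner (b ∘ fs) s

  ∑-pow≡horner : ∀ {m} (b : Fin m → Carrier) s → ∑ (λ a → b a * pow s (toℕ a)) ≡ horner b s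
  ∑-pow≡horner {zero}  b s = refl
  ∑-pow≡horner {suc m} b s = cong₂ _+_ (*-identityʳ (b fz)) (begin
    ∑ (λ a → b (fs a) * (s * pow s (toℕ a)))  ≡⟨ ∑-cong (λ a → x*yz≡y*xz (b (fs a)) s _) ⟩
    ∑ (λ a → s * (b (fs a) * pow s (toℕ a)))  ≡⟨ sym (*-distribˡ-∑ {m} s _) ⟩
    s * ∑ (λ a → b (fs a) * pow s (toℕ a))    ≡⟨ cong (s *_) (∑-pow≡horner (b ∘ fs) s) ⟩
    s * horner (b ∘ fs) s                     ∎)
    where open ≡-Reasoning

  -- Synthetic division of b by (X - ρ); the remainder is horner b ρ.
  quotient : ∀ {m} → Carrier → (Fin (suc m) → Carrier) → Fin m → Carrier
  quotient ρ b fz     = horner (b ∘ fs) ρ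
  quotient ρ b (fs i) = quotient ρ (b ∘ fs) i

  horner-division : ∀ {m} ρ (b : Fin (suc m) → Carrier) s →
    horner b s ≡ (s - ρ) * horner (quotient ρ b) s + horner b ρ
  horner-division {zero} ρ b s = begin
    b fz + s * 0#               ≡⟨ cong (b fz +_) (zeroʳ s) ⟩
    b fz + 0#                   ≡⟨ sym (+-identityˡ _) ⟩
    0# + (b fz + 0#)            ≡⟨ sym (cong₂ _+_ (zeroʳ (s - ρ)) (cong (b fz +_) (zeroʳ ρ))) ⟩
    (s - ρ) * 0# + (b fz + ρ * 0#) ∎
    where open ≡-Reasoning
  horner-division {suc m} ρ b s = begin
    b fz + s * horner (b ∘ fs) s
      ≡⟨ cong (λ u → b fz + s * u) (horner-division ρ (b ∘ fs) s) ⟩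
    b fz + s * ((s - ρ) * Q + R)
      ≡⟨ step (x-y+y≡x s ρ) ⟩
    (s - ρ) * (R + s * Q) + (b fz + ρ * R) ∎
    where
    open ≡-Reasoning
    Q = horner (quotient ρ (b ∘ fs)) s
    R = horner (b ∘ fs) ρ
    step : ∀ {u} → (s - ρ) + ρ ≡ u → b fz + u * ((s - ρ) * Q + R) ≡ (s - ρ) * (R + u * Q) + (b fz + ρ * R)
    step refl = ≈⇒≡ (division-step commRing (b fz) (s - ρ) ρ Q R)

  horner-head : ∀ {m} (b : Fin (suc m) → Carrier) s → horner (b ∘ fs) s ≡ 0# → horner b s ≡ b fz
  horner-head b s tail≡0 =
    trans (cong (λ u → b fz + s * u) tail≡0) (trans (cong (b fz +_) (zeroʳ s)) (+-identityʳ (b fz)))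

  quotient-zero⇒zero : ∀ {m} ρ (b : Fin (suc m) → Carrier) →
    (∀ i → quotient ρ b i ≡ 0#) → horner b ρ ≡ 0# → ∀ i → b i ≡ 0#
  quotient-zero⇒zero {zero}  ρ b Q≡0 b[ρ]≡0 fz     = trans (sym (horner-head b ρ refl)) b[ρ]≡0
  quotient-zero⇒zero {suc m} ρ b Q≡0 b[ρ]≡0 fz     = trans (sym (horner-head b ρ (Q≡0 fz))) b[ρ]≡0
  quotient-zero⇒zero {suc m} ρ b Q≡0 b[ρ]≡0 (fs i) = quotient-zero⇒zero ρ (b ∘ fs) (Q≡0 ∘ fs) (Q≡0 fz) i

  horner-roots⇒zero : ∀ {m} (b ρ : Fin m → Carrier) → (∀ i j → ρ i ≡ ρ j → i ≡ j) →
    (∀ i → horner b (ρ i) ≡ 0#) → ∀ i → b i ≡ 0#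
  horner-roots⇒zero {suc m} b ρ ρ-inj b[ρ]≡0 =
    quotient-zero⇒zero (ρ fz) b
      (horner-roots⇒zero Q (ρ ∘ fs) (λ i j ρᵢ≡ρⱼ → Finₚ.suc-injective (ρ-inj _ _ ρᵢ≡ρⱼ)) Q[ρ]≡0)
      (b[ρ]≡0 fz)
    where
    Q = quotient (ρ fz) b
    Q[ρ]≡0 : ∀ i → horner Q (ρ (fs i)) ≡ 0#
    Q[ρ]≡0 i = xy≡0⇒y≡0 (λ ρᵢ-ρ₀≡0 → Finₚ.0≢1+n (ρ-inj fz (fs i) (sym (x-y≡0⇒x≡y ρᵢ-ρ₀≡0))))
      (begin
      (ρᵢ - ρ fz) * horner Q ρᵢ                    ≡⟨ sym (+-identityʳ _) ⟩
      (ρᵢ - ρ fz) * horner Q ρᵢ + 0#               ≡⟨ cong ((ρᵢ - ρ fz) * horner Q ρᵢ +_) (sym (b[ρ]≡0 fz)) ⟩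
      (ρᵢ - ρ fz) * horner Q ρᵢ + horner b (ρ fz)  ≡⟨ sym (horner-division (ρ fz) b ρᵢ) ⟩
      horner b ρᵢ                                  ≡⟨ b[ρ]≡0 (fs i) ⟩
      0#                                           ∎)
      where
      open ≡-Reasoning
      ρᵢ = ρ (fs i)

  univariate-vanishing⇒zero : (b : Fin q → Carrier) →
    (∀ s → ∑ (λ a → b a * pow s (toℕ a)) ≡ 0#) → ∀ a → b a ≡ 0#
  univariate-vanishing⇒zero b b≡0 =
    horner-roots⇒zero b enum enum-inj (λ i → trans (sym (∑-pow≡horner b (enum i))) (b≡0 (enum i)))

  multivariate-vanishing⇒zero : ∀ k (c : (Fin k → Fin q) → Carrier) → Extensional c →
    (∀ t → ∑ᴸ (allIdx q k) (λ α → c α * monomial α t) ≡ 0#) → ∀ α → c α ≡ 0#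
  multivariate-vanishing⇒zero zero c c-ext c≡0 α = only _ (c≡0 (λ ()))
    where
    only : ∀ α₀ → c α₀ * 1# + 0# ≡ 0# → c α ≡ 0#
    only α₀ cα₀≡0 = trans (c-ext (λ ())) (trans (sym (trans (+-identityʳ _) (*-identityʳ _))) cα₀≡0)
  multivariate-vanishing⇒zero (suc k) c c-ext c≡0 α =
    trans (c-ext (λ { fz → refl ; (fs i) → refl })) (slice≡0 (α fz) (α ∘ fs))
    where
    row : Fin q → Point k → Carrier
    row a t = ∑ᴸ (allIdx q k) (λ β → c (a ◂ β) * monomial β t)
    row≡0 : ∀ t a → row a t ≡ 0#
    row≡0 t = univariate-vanishing⇒zero (λ a → row a t) λ s → begin
      ∑ (λ a → row a t * pow s (toℕ a))
        ≡⟨ ∑-cong (λ a → trans (*-comm _ _) (trans (*-distribˡ-∑ᴸ (allIdx q k) _ _)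
             (∑ᴸ-cong (allIdx q k) (λ β → x*yz≡y*xz (pow s (toℕ a)) (c (a ◂ β)) _)))) ⟩
      ∑ (λ a → ∑ᴸ (allIdx q k) (λ β → c (a ◂ β) * monomial (a ◂ β) (s ◂ t)))
        ≡⟨ sym (∑ᴸ-allIdx-◂ k _ (λ e≐e′ → cong₂ _*_ (c-ext e≐e′) (monomial-≐ (s ◂ t) e≐e′))) ⟩
      ∑ᴸ (allIdx q (suc k)) (λ α → c α * monomial α (s ◂ t))
        ≡⟨ c≡0 (s ◂ t) ⟩
      0# ∎
      where open ≡-Reasoning
    slice≡0 : ∀ a β → c (a ◂ β) ≡ 0#
    slice≡0 a = multivariate-vanishing⇒zero k (c ∘ (a ◂_))
      (λ e≐e′ → c-ext (λ { fz → refl ; (fs i) → e≐e′ i })) (λ t → row≡0 t a)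

module Fermat {m : ℕ} (F : FiniteField (suc m)) where
  open FiniteField F using (Carrier; _*_; 0#; 1#; 0≢1; inverse; enum)
  open FF F
  open FieldFacts F

  private
    -- ∏ ι over the field is a unit, and scaling the field by y ≠ 0 multiplies it by y ^ (q - 1).
    ι : Carrier → Carrier
    ι z = if does (z ≟ 0#) then 1# else z

    ι≢0 : ∀ z → ¬ ι z ≡ 0#
    ι≢0 z with z ≟ 0#
    ... | yes _   = λ 1≡0 → 0≢1 (sym 1≡0)
    ... | no  z≢0 = z≢0

    ι-* : ∀ {y} → ¬ y ≡ 0# → ∀ z → ι (y * z) ≡ (if does (z ≟ 0#) then 1# else y) * ι z
    ι-* {y} y≢0 z with z ≟ 0# | (y * z) ≟ 0#
    ... | yes _   | yes _    = sym (*-identityˡ 1#)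
    ... | yes z≡0 | no yz≢0  = contradiction (trans (cong (y *_) z≡0) (zeroʳ y)) yz≢0
    ... | no z≢0  | yes yz≡0 = contradiction (xy≡0⇒y≡0 y≢0 yz≡0) z≢0
    ... | no _    | no _     = refl

    scaling : ∀ {y} → ¬ y ≡ 0# → Permutation′ (suc m)
    scaling {y} y≢0 = permutation (λ i → index (y * enum i)) (λ i → index (y⁻¹ * enum i))
      (cancel yy⁻¹≡1) (cancel (trans (*-comm y⁻¹ y) yy⁻¹≡1))
      where
      y⁻¹ = proj₁ (inverse y y≢0)
      yy⁻¹≡1 = proj₂ (inverse y y≢0)
      cancel : ∀ {a b} → a * b ≡ 1# → ∀ i → index (a * enum (index (b * enum i))) ≡ i
      cancel {a} {b} ab≡1 i = trans (cong (λ z → index (a * z)) (enum-index _))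
        (trans (cong index (trans (sym (*-assoc a b _)) (trans (cong (_* enum i) ab≡1) (*-identityˡ _))))
          (index-enum i))

    ∏ι-scaled : ∀ {y} → ¬ y ≡ 0# → ∏ (ι ∘ enum) ≡ pow y m * ∏ (ι ∘ enum)
    ∏ι-scaled {y} y≢0 = begin
      ∏ (ι ∘ enum)                             ≡⟨ ∏-permute (ι ∘ enum) (scaling y≢0) ⟩
      ∏ (λ i → ι (enum (index (y * enum i))))  ≡⟨ ∏-cong {suc m} (λ i → cong ι (enum-index (y * enum i))) ⟩
      ∏ (λ i → ι (y * enum i))                 ≡⟨ ∏-cong {suc m} (λ i → ι-* y≢0 (enum i)) ⟩
      ∏ (λ i → factor i * ι (enum i))          ≡⟨ ∏-distrib-* factor (ι ∘ enum) ⟩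
      ∏ factor * ∏ (ι ∘ enum)                  ≡⟨ cong (_* ∏ (ι ∘ enum)) ∏factor≡yᵐ ⟩
      pow y m * ∏ (ι ∘ enum)                   ∎
      where
      open ≡-Reasoning
      factor : Fin (suc m) → Carrier
      factor i = if does (enum i ≟ 0#) then 1# else y
      ∏factor≡yᵐ : ∏ factor ≡ pow y m
      ∏factor≡yᵐ = ∏-const-except factor y (index 0#)
        (cong (if_then 1# else y) (dec-true (enum (index 0#) ≟ 0#) (enum-index 0#)))
        (λ i i≢i₀ → cong (if_then 1# else y)
          (dec-false (enum i ≟ 0#) (λ enumᵢ≡0 → i≢i₀ (trans (sym (index-enum i)) (cong index enumᵢ≡0)))))

  pow-pred≡1 : ∀ {y} → ¬ y ≡ 0# → pow y m ≡ 1#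
  pow-pred≡1 {y} y≢0 with ∏-invertible (ι ∘ enum) (ι≢0 ∘ enum)
  ... | b , ∏ιb≡1 = begin
    pow y m                        ≡⟨ sym (*-identityʳ _) ⟩
    pow y m * 1#                   ≡⟨ cong (pow y m *_) (sym ∏ιb≡1) ⟩
    pow y m * (∏ (ι ∘ enum) * b)   ≡⟨ sym (*-assoc _ _ b) ⟩
    (pow y m * ∏ (ι ∘ enum)) * b   ≡⟨ cong (_* b) (sym (∏ι-scaled y≢0)) ⟩
    ∏ (ι ∘ enum) * b               ≡⟨ ∏ιb≡1 ⟩
    1#                             ∎
    where open ≡-Reasoning

  pow-size : ∀ y → pow y (suc m) ≡ y
  pow-size y with y ≟ 0#
  ... | yes refl = zeroˡ _
  ... | no  y≢0  = trans (cong (y *_) (pow-pred≡1 y≢0)) (*-identityʳ y)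

module Exponents (r : ℕ) (F : FiniteField (suc (suc r))) where
  open FiniteField F using (_*_; 1#)
  open FF F
  open FieldFacts F
  open Sifting F using (_≐_)
  open Fermat F

  private
    q : ℕ
    q = suc (suc r)

  1+excess<q : ∀ (a b : Fin q) → suc (toℕ a +ℕ toℕ b ∸ℕ q) < q
  1+excess<q a b = s≤s (s≤s (ℕₚ.≤-trans
    (ℕₚ.∸-monoˡ-≤ q (ℕₚ.+-mono-≤ (Finₚ.toℕ≤pred[n] a) (Finₚ.toℕ≤pred[n] b)))
    (ℕₚ.≤-reflexive (ℕₚ.m+n∸n≡m r (suc r)))))

  -- Exponents add subject to y ^ q = y: the exponent q + u is replaced by 1 + u.
  _+ᵉ_ : Fin q → Fin q → Fin q
  a +ᵉ b with toℕ a +ℕ toℕ b ℕ.<? q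
  ... | yes a+b<q = fromℕ< a+b<q
  ... | no  _     = fromℕ< (1+excess<q a b)

  toℕ-+ᵉ-≤ : ∀ a b → toℕ (a +ᵉ b) ≤ toℕ a +ℕ toℕ b
  toℕ-+ᵉ-≤ a b with toℕ a +ℕ toℕ b ℕ.<? q
  ... | yes a+b<q = ℕₚ.≤-reflexive (Finₚ.toℕ-fromℕ< a+b<q)
  ... | no  a+b≮q = subst (toℕ (fromℕ< (1+excess<q a b)) ≤_) (ℕₚ.m+[n∸m]≡n (ℕₚ.≮⇒≥ a+b≮q))
      (ℕₚ.≤-trans (ℕₚ.≤-reflexive (Finₚ.toℕ-fromℕ< (1+excess<q a b))) (s≤s (ℕₚ.m≤n+m _ (suc r))))

  pow-+ᵉ : ∀ y a b → pow y (toℕ (a +ᵉ b)) ≡ pow y (toℕ a) * pow y (toℕ b)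
  pow-+ᵉ y a b with toℕ a +ℕ toℕ b ℕ.<? q
  ... | yes a+b<q = trans (cong (pow y) (Finₚ.toℕ-fromℕ< a+b<q)) (pow-+ y (toℕ a) (toℕ b))
  ... | no  a+b≮q = begin
    pow y (toℕ (fromℕ< (1+excess<q a b)))  ≡⟨ cong (pow y) (Finₚ.toℕ-fromℕ< (1+excess<q a b)) ⟩
    y * pow y u                            ≡⟨ cong (_* pow y u) (sym (pow-size y)) ⟩
    pow y q * pow y u                      ≡⟨ sym (pow-+ y q u) ⟩
    pow y (q +ℕ u)                         ≡⟨ cong (pow y) (ℕₚ.m+[n∸m]≡n (ℕₚ.≮⇒≥ a+b≮q)) ⟩
    pow y (toℕ a +ℕ toℕ b)                 ≡⟨ pow-+ y (toℕ a) (toℕ b) ⟩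
    pow y (toℕ a) * pow y (toℕ b)          ∎
    where
    open ≡-Reasoning
    u = toℕ a +ℕ toℕ b ∸ℕ q

  0ᵛ : ∀ {m} → Fin m → Fin q
  0ᵛ _ = fz

  unitᵛ : ∀ {m} → Fin m → Fin m → Fin q
  unitᵛ fz     fz     = fs fz
  unitᵛ fz     (fs _) = fz
  unitᵛ (fs _) fz     = fz
  unitᵛ (fs j) (fs i) = unitᵛ j i

  _+ᵛ_ : ∀ {m} → (Fin m → Fin q) → (Fin m → Fin q) → Fin m → Fin q
  (e +ᵛ e′) j = e j +ᵉ e′ j

  wt-0ᵛ : ∀ {m} → wt {q} {m} 0ᵛ ≡ 0
  wt-0ᵛ {zero}  = refl
  wt-0ᵛ {suc m} = wt-0ᵛ {m}

  wt-unitᵛ : ∀ {m} (j : Fin m) → wt (unitᵛ j) ≤ 1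
  wt-unitᵛ {suc m} fz     = s≤s (ℕₚ.≤-reflexive (wt-0ᵛ {m}))
  wt-unitᵛ         (fs j) = wt-unitᵛ j

  wt-+ᵛ : ∀ {m} (e e′ : Fin m → Fin q) → wt (e +ᵛ e′) ≤ wt e +ℕ wt e′
  wt-+ᵛ {zero}  e e′ = z≤n
  wt-+ᵛ {suc m} e e′ = ℕₚ.≤-trans (ℕₚ.+-mono-≤ (toℕ-+ᵉ-≤ (e fz) (e′ fz)) (wt-+ᵛ (e ∘ fs) (e′ ∘ fs)))
    (ℕₚ.≤-reflexive (ℕ-CS.interchange (toℕ (e fz)) (toℕ (e′ fz)) (wt (e ∘ fs)) (wt (e′ ∘ fs))))

  wt-≐ : ∀ {m} {e e′ : Fin m → Fin q} → e ≐ e′ → wt e ≡ wt e′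
  wt-≐ {zero}  e≐e′ = refl
  wt-≐ {suc m} e≐e′ = cong₂ _+ℕ_ (cong toℕ (e≐e′ fz)) (wt-≐ (e≐e′ ∘ fs))

  monomial-0ᵛ : ∀ {m} (x : Point m) → monomial 0ᵛ x ≡ 1#
  monomial-0ᵛ {m} x = ∏-1 m

  monomial-unitᵛ : ∀ {m} (j : Fin m) (x : Point m) → monomial (unitᵛ j) x ≡ x j
  monomial-unitᵛ {suc m} fz     x = trans (cong₂ _*_ (*-identityʳ (x fz)) (∏-1 m)) (*-identityʳ (x fz))
  monomial-unitᵛ         (fs j) x = trans (*-identityˡ _) (monomial-unitᵛ j (x ∘ fs))

  monomial-+ᵛ : ∀ {m} (e e′ : Fin m → Fin q) (x : Point m) →
    monomial (e +ᵛ e′) x ≡ monomial e x * monomial e′ x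
  monomial-+ᵛ e e′ x = trans (∏-cong (λ j → pow-+ᵉ (x j) (e j) (e′ j)))
    (∏-distrib-* (λ j → pow (x j) (toℕ (e j))) (λ j → pow (x j) (toℕ (e′ j))))

module Expansion (r : ℕ) (F : FiniteField (suc (suc r))) where
  open FiniteField F using (Carrier; _+_; _*_; 0#; 1#)
  open FF F
  open FieldFacts F
  open ListSums F
  open Sifting F
  open ReducedPolynomials F
  open Exponents r F

  private
    q : ℕ
    q = suc (suc r)

  record Term (n k : ℕ) : Set where
    constructor term
    field
      coeff : Carrier
      xexp  : Fin n → Fin q
      texp  : Fin k → Fin q
  open Term

  module _ {n k : ℕ} where

    ⟦_⟧ : Term n k → Point n → Point k → Carrier
    ⟦ term c e β ⟧ x t = c * (monomial e x * monomial β t)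

    ⟦_⟧ᴸ : List (Term n k) → Point n → Point k → Carrier
    ⟦ L ⟧ᴸ x t = ∑ᴸ L (λ τ → ⟦ τ ⟧ x t)

    degree : Term n k → ℕ
    degree (term _ e β) = wt e +ℕ wt β

    Degree≤ : ℕ → List (Term n k) → Set
    Degree≤ d L = All (λ τ → degree τ ≤ d) L

    const : Carrier → List (Term n k)
    const c = term c 0ᵛ 0ᵛ ∷ []

    ⟦const⟧ : ∀ c x t → ⟦ const c ⟧ᴸ x t ≡ c
    ⟦const⟧ c x t = begin
      c * (monomial 0ᵛ x * monomial 0ᵛ t) + 0#  ≡⟨ +-identityʳ _ ⟩
      c * (monomial 0ᵛ x * monomial 0ᵛ t)       ≡⟨ cong (c *_) (cong₂ _*_ (monomial-0ᵛ x) (monomial-0ᵛ t)) ⟩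
      c * (1# * 1#)                             ≡⟨ cong (c *_) (*-identityˡ 1#) ⟩
      c * 1#                                    ≡⟨ *-identityʳ c ⟩
      c                                         ∎
      where open ≡-Reasoning

    degree-const : ∀ c → Degree≤ 0 (const c)
    degree-const c = ℕₚ.≤-reflexive (cong₂ _+ℕ_ (wt-0ᵛ {n}) (wt-0ᵛ {k})) ∷ []

    _*ᵀ_ : Term n k → Term n k → Term n k
    term c e β *ᵀ term c′ e′ β′ = term (c * c′) (e +ᵛ e′) (β +ᵛ β′)

    ⟦*ᵀ⟧ : ∀ τ τ′ x t → ⟦ τ *ᵀ τ′ ⟧ x t ≡ ⟦ τ ⟧ x t * ⟦ τ′ ⟧ x t
    ⟦*ᵀ⟧ (term c e β) (term c′ e′ β′) x t = begin
      (c * c′) * (monomial (e +ᵛ e′) x * monomial (β +ᵛ β′) t)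
        ≡⟨ cong ((c * c′) *_) (cong₂ _*_ (monomial-+ᵛ e e′ x) (monomial-+ᵛ β β′ t)) ⟩
      (c * c′) * ((monomial e x * monomial e′ x) * (monomial β t * monomial β′ t))
        ≡⟨ cong ((c * c′) *_) (*-interchange _ _ _ _) ⟩
      (c * c′) * ((monomial e x * monomial β t) * (monomial e′ x * monomial β′ t))
        ≡⟨ *-interchange _ _ _ _ ⟩
      (c * (monomial e x * monomial β t)) * (c′ * (monomial e′ x * monomial β′ t)) ∎
      where open ≡-Reasoning

    degree-*ᵀ : ∀ {a b} τ τ′ → degree τ ≤ a → degree τ′ ≤ b → degree (τ *ᵀ τ′) ≤ a +ℕ b
    degree-*ᵀ (term _ e β) (term _ e′ β′) τ≤a τ′≤b = ℕₚ.≤-trans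
      (ℕₚ.+-mono-≤ (wt-+ᵛ e e′) (wt-+ᵛ β β′))
      (ℕₚ.≤-trans (ℕₚ.≤-reflexive (ℕ-CS.interchange (wt e) (wt e′) (wt β) (wt β′)))
        (ℕₚ.+-mono-≤ τ≤a τ′≤b))

    _⋆_ : List (Term n k) → List (Term n k) → List (Term n k)
    L ⋆ L′ = concatMap (λ τ → map (τ *ᵀ_) L′) L

    ⟦⋆⟧ : ∀ L L′ x t → ⟦ L ⋆ L′ ⟧ᴸ x t ≡ ⟦ L ⟧ᴸ x t * ⟦ L′ ⟧ᴸ x t
    ⟦⋆⟧ L L′ x t = begin
      ⟦ L ⋆ L′ ⟧ᴸ x t
        ≡⟨ ∑ᴸ-concatMap _ L _ ⟩
      ∑ᴸ L (λ τ → ∑ᴸ (map (τ *ᵀ_) L′) (λ σ → ⟦ σ ⟧ x t))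
        ≡⟨ ∑ᴸ-cong L (λ τ → trans (∑ᴸ-map (τ *ᵀ_) L′ _) (∑ᴸ-cong L′ (λ τ′ → ⟦*ᵀ⟧ τ τ′ x t))) ⟩
      ∑ᴸ L (λ τ → ∑ᴸ L′ (λ τ′ → ⟦ τ ⟧ x t * ⟦ τ′ ⟧ x t))
        ≡⟨ ∑ᴸ-cong L (λ τ → sym (*-distribˡ-∑ᴸ L′ (⟦ τ ⟧ x t) _)) ⟩
      ∑ᴸ L (λ τ → ⟦ τ ⟧ x t * ⟦ L′ ⟧ᴸ x t)
        ≡⟨ sym (*-distribʳ-∑ᴸ L _ _) ⟩
      ⟦ L ⟧ᴸ x t * ⟦ L′ ⟧ᴸ x t ∎
      where open ≡-Reasoning

    degree-⋆ : ∀ {a b L L′} → Degree≤ a L → Degree≤ b L′ → Degree≤ (a +ℕ b) (L ⋆ L′)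
    degree-⋆ L≤a L′≤b = Allₚ.concat⁺ (Allₚ.map⁺ (All.map (λ {τ} τ≤a →
      Allₚ.map⁺ (All.map (λ {τ′} τ′≤b → degree-*ᵀ τ τ′ τ≤a τ′≤b) L′≤b)) L≤a))

    _^ᵀ_ : List (Term n k) → ℕ → List (Term n k)
    L ^ᵀ zero  = const 1#
    L ^ᵀ suc a = L ⋆ (L ^ᵀ a)

    ⟦^ᵀ⟧ : ∀ L a x t → ⟦ L ^ᵀ a ⟧ᴸ x t ≡ pow (⟦ L ⟧ᴸ x t) a
    ⟦^ᵀ⟧ L zero    x t = ⟦const⟧ 1# x t
    ⟦^ᵀ⟧ L (suc a) x t = trans (⟦⋆⟧ L (L ^ᵀ a) x t) (cong (⟦ L ⟧ᴸ x t *_) (⟦^ᵀ⟧ L a x t))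

    degree-^ᵀ : ∀ {L} a → Degree≤ 1 L → Degree≤ a (L ^ᵀ a)
    degree-^ᵀ zero    L≤1 = degree-const 1#
    degree-^ᵀ (suc a) L≤1 = degree-⋆ L≤1 (degree-^ᵀ a L≤1)

    ∏ᵀ : ∀ {m} → (Fin m → List (Term n k)) → List (Term n k)
    ∏ᵀ {zero}  G = const 1#
    ∏ᵀ {suc m} G = G fz ⋆ ∏ᵀ (G ∘ fs)

    ⟦∏ᵀ⟧ : ∀ {m} (G : Fin m → List (Term n k)) x t → ⟦ ∏ᵀ G ⟧ᴸ x t ≡ ∏ (λ j → ⟦ G j ⟧ᴸ x t)
    ⟦∏ᵀ⟧ {zero}  G x t = ⟦const⟧ 1# x t
    ⟦∏ᵀ⟧ {suc m} G x t =
      trans (⟦⋆⟧ (G fz) (∏ᵀ (G ∘ fs)) x t) (cong (⟦ G fz ⟧ᴸ x t *_) (⟦∏ᵀ⟧ (G ∘ fs) x t))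

    degree-∏ᵀ : ∀ {m} {G : Fin m → List (Term n k)} (e : Fin m → Fin q) →
      (∀ j → Degree≤ (toℕ (e j)) (G j)) → Degree≤ (wt e) (∏ᵀ G)
    degree-∏ᵀ {zero}  e G≤e = degree-const 1#
    degree-∏ᵀ {suc m} e G≤e = degree-⋆ (G≤e fz) (degree-∏ᵀ (e ∘ fs) (G≤e ∘ fs))

  module _ {n k : ℕ} (Δ : Fin k → Point n) where

    shiftedCoordinate : Fin n → List (Term n k)
    shiftedCoordinate j = term 1# (unitᵛ j) 0ᵛ ∷ map (λ i → term (Δ i j) 0ᵛ (unitᵛ i)) (allFin k)

    ⟦shiftedCoordinate⟧ : ∀ j x t → ⟦ shiftedCoordinate j ⟧ᴸ x t ≡ (x ⊕ lincomb t Δ) j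
    ⟦shiftedCoordinate⟧ j x t = cong₂ _+_
      (trans (*-identityˡ _) (trans (cong₂ _*_ (monomial-unitᵛ j x) (monomial-0ᵛ t)) (*-identityʳ (x j))))
      (trans (∑ᴸ-map _ (allFin k) _) (trans (∑ᴸ-tabulate {m = k} (λ i → i) _) (∑-cong {k} λ i → begin
        Δ i j * (monomial 0ᵛ x * monomial (unitᵛ i) t)
          ≡⟨ cong (Δ i j *_) (cong₂ _*_ (monomial-0ᵛ x) (monomial-unitᵛ i t)) ⟩
        Δ i j * (1# * t i)
          ≡⟨ cong (Δ i j *_) (*-identityˡ (t i)) ⟩
        Δ i j * t i
          ≡⟨ *-comm (Δ i j) (t i) ⟩
        t i * Δ i j ∎)))
      where open ≡-Reasoning

    degree-shiftedCoordinate : ∀ j → Degree≤ 1 (shiftedCoordinate j)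
    degree-shiftedCoordinate j =
      subst (_≤ 1) (sym (trans (cong (wt (unitᵛ j) +ℕ_) (wt-0ᵛ {k})) (ℕₚ.+-identityʳ _))) (wt-unitᵛ j)
      ∷ Allₚ.map⁺ (All.universal
          (λ i → subst (_≤ 1) (sym (cong (_+ℕ wt (unitᵛ i)) (wt-0ᵛ {n}))) (wt-unitᵛ i)) (allFin k))

    module _ (P : Poly n) (d : ℕ) (P-deg : DegLe P d) where

      -- Monomials of degree > d have coefficient 0 in P; omitting them makes the degree bound hold termwise.
      shiftedMonomial : (Fin n → Fin q) → List (Term n k)
      shiftedMonomial e with wt e ℕ.≤? d
      ... | yes _ = const (P e) ⋆ ∏ᵀ (λ j → shiftedCoordinate j ^ᵀ toℕ (e j))
      ... | no  _ = []

      ⟦shiftedMonomial⟧ : ∀ e x t → ⟦ shiftedMonomial e ⟧ᴸ x t ≡ P e * monomial e (x ⊕ lincomb t Δ)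
      ⟦shiftedMonomial⟧ e x t with wt e ℕ.≤? d
      ... | yes _ = begin
        ⟦ const (P e) ⋆ ∏ᵀ G ⟧ᴸ x t
          ≡⟨ ⟦⋆⟧ (const (P e)) (∏ᵀ G) x t ⟩
        ⟦ const (P e) ⟧ᴸ x t * ⟦ ∏ᵀ G ⟧ᴸ x t
          ≡⟨ cong₂ _*_ (⟦const⟧ (P e) x t) (⟦∏ᵀ⟧ G x t) ⟩
        P e * ∏ (λ j → ⟦ G j ⟧ᴸ x t)
          ≡⟨ cong (P e *_) (∏-cong {n} λ j → trans (⟦^ᵀ⟧ _ (toℕ (e j)) x t)
               (cong (λ y → pow y (toℕ (e j))) (⟦shiftedCoordinate⟧ j x t))) ⟩
        P e * monomial e (x ⊕ lincomb t Δ) ∎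
        where
        open ≡-Reasoning
        G = λ j → shiftedCoordinate j ^ᵀ toℕ (e j)
      ... | no e≰d = sym (trans (cong (_* _) (P-deg e d<e)) (zeroˡ _))
        where
        d<e : d < wt e +ℕ 0
        d<e = subst (d <_) (sym (ℕₚ.+-identityʳ (wt e))) (ℕₚ.≰⇒> e≰d)

      degree-shiftedMonomial : ∀ e → Degree≤ d (shiftedMonomial e)
      degree-shiftedMonomial e with wt e ℕ.≤? d
      ... | yes e≤d = All.map (λ τ≤e → ℕₚ.≤-trans τ≤e e≤d) (degree-⋆ (degree-const (P e))
                        (degree-∏ᵀ e (λ j → degree-^ᵀ (toℕ (e j)) (degree-shiftedCoordinate j))))
      ... | no  _   = []

      shifted : List (Term n k)
      shifted = concatMap shiftedMonomial (allIdx q n)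

      ⟦shifted⟧ : ∀ x t → ⟦ shifted ⟧ᴸ x t ≡ eval P (x ⊕ lincomb t Δ)
      ⟦shifted⟧ x t = trans (∑ᴸ-concatMap shiftedMonomial (allIdx q n) _)
        (∑ᴸ-cong (allIdx q n) (λ e → ⟦shiftedMonomial⟧ e x t))

      degree-shifted : Degree≤ d shifted
      degree-shifted = Allₚ.concat⁺ (Allₚ.map⁺ (All.universal degree-shiftedMonomial (allIdx q n)))

      coeffAt : (Fin k → Fin q) → Term n k → Carrier
      coeffAt α τ = when (texp τ ≐? α) (coeff τ)

      coefficient : (Fin k → Fin q) → Poly n
      coefficient α e = ∑ᴸ shifted (λ τ → when (xexp τ ≐? e) (coeffAt α τ))

      coefficient-degree : ∀ α → DegLeMinus (coefficient α) d (wt α)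
      coefficient-degree α e d<e+α = ∑ᴸ-zero (All.map (λ {τ} → vanishes τ) degree-shifted)
        where
        vanishes : ∀ τ → degree τ ≤ d → when (xexp τ ≐? e) (coeffAt α τ) ≡ 0#
        vanishes (term c e′ β) τ≤d with e′ ≐? e | β ≐? α
        ... | no _     | _       = refl
        ... | yes _    | no _    = refl
        ... | yes e′≐e | yes β≐α =
          contradiction (subst (_≤ d) (cong₂ _+ℕ_ (wt-≐ e′≐e) (wt-≐ β≐α)) τ≤d) (ℕₚ.<⇒≱ d<e+α)

      eval-coefficient : ∀ α x →
        eval (coefficient α) x ≡ ∑ᴸ shifted (λ τ → coeffAt α τ * monomial (xexp τ) x)
      eval-coefficient α x = begin
        ∑ᴸ (allIdx q n) (λ e → coefficient α e * monomial e x)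
          ≡⟨ ∑ᴸ-cong (allIdx q n) (λ e → trans (*-distribʳ-∑ᴸ shifted _ _)
               (∑ᴸ-cong shifted (λ τ → when-*ʳ (xexp τ ≐? e) _ _))) ⟩
        ∑ᴸ (allIdx q n) (λ e → ∑ᴸ shifted (λ τ → when (xexp τ ≐? e) (coeffAt α τ * monomial e x)))
          ≡⟨ ∑ᴸ-allIdx-collect shifted xexp _ (λ τ e≐e′ → cong (coeffAt α τ *_) (monomial-≐ x e≐e′)) ⟩
        ∑ᴸ shifted (λ τ → coeffAt α τ * monomial (xexp τ) x) ∎
        where open ≡-Reasoning

      eval-coefficient-≐ : ∀ x → Extensional (λ α → eval (coefficient α) x)
      eval-coefficient-≐ x {α} {α′} α≐α′ = begin
        eval (coefficient α) x                               ≡⟨ eval-coefficient α x ⟩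
        ∑ᴸ shifted (λ τ → coeffAt α τ * monomial (xexp τ) x)
          ≡⟨ ∑ᴸ-cong shifted (λ τ → cong (_* monomial (xexp τ) x) (when-≐ (texp τ) α≐α′ (coeff τ))) ⟩
        ∑ᴸ shifted (λ τ → coeffAt α′ τ * monomial (xexp τ) x) ≡⟨ sym (eval-coefficient α′ x) ⟩
        eval (coefficient α′) x                              ∎
        where open ≡-Reasoning

      expansion : ∀ x t →
        eval P (x ⊕ lincomb t Δ) ≡ ∑ᴸ (allIdx q k) (λ α → eval (coefficient α) x * monomial α t)
      expansion x t = sym (begin
        ∑ᴸ (allIdx q k) (λ α → eval (coefficient α) x * monomial α t)
          ≡⟨ ∑ᴸ-cong (allIdx q k) (λ α → trans (cong (_* monomial α t) (eval-coefficient α x))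
               (trans (*-distribʳ-∑ᴸ shifted _ _) (∑ᴸ-cong shifted (λ τ →
                 trans (cong (_* monomial α t) (when-*ʳ (texp τ ≐? α) _ _)) (when-*ʳ (texp τ ≐? α) _ _))))) ⟩
        ∑ᴸ (allIdx q k) (λ α → ∑ᴸ shifted (λ τ →
          when (texp τ ≐? α) ((coeff τ * monomial (xexp τ) x) * monomial α t)))
          ≡⟨ ∑ᴸ-allIdx-collect shifted texp _
               (λ τ α≐α′ → cong (coeff τ * monomial (xexp τ) x *_) (monomial-≐ t α≐α′)) ⟩
        ∑ᴸ shifted (λ τ → (coeff τ * monomial (xexp τ) x) * monomial (texp τ) t)
          ≡⟨ ∑ᴸ-cong shifted (λ τ → *-assoc _ _ _) ⟩
        ⟦ shifted ⟧ᴸ x t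
          ≡⟨ ⟦shifted⟧ x t ⟩
        eval P (x ⊕ lincomb t Δ) ∎)
        where open ≡-Reasoning

      coset-vanishing⇔coefficients-vanish : (f : Point n → Carrier) → (∀ y → eval P y ≡ f y) → ∀ x →
        (∀ u → InSpan Δ u → f (x ⊕ u) ≡ 0#) ⇔ (∀ α → eval (coefficient α) x ≡ 0#)
      coset-vanishing⇔coefficients-vanish f P≗f x = mk⇔ vanishing⇒coefficients coefficients⇒vanishing
        where
        vanishing⇒coefficients : (∀ u → InSpan Δ u → f (x ⊕ u) ≡ 0#) → ∀ α → eval (coefficient α) x ≡ 0#
        vanishing⇒coefficients f≡0 = multivariate-vanishing⇒zero k _ (eval-coefficient-≐ x)
          (λ t → trans (sym (expansion x t)) (trans (P≗f _) (f≡0 (lincomb t Δ) (t , λ _ → refl))))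
        coefficients⇒vanishing : (∀ α → eval (coefficient α) x ≡ 0#) → ∀ u → InSpan Δ u → f (x ⊕ u) ≡ 0#
        coefficients⇒vanishing c≡0 u (t , u≗tΔ) = begin
          f (x ⊕ u)                 ≡⟨ sym (P≗f _) ⟩
          eval P (x ⊕ u)            ≡⟨ eval-pointwise P (λ j → cong (x j +_) (u≗tΔ j)) ⟩
          eval P (x ⊕ lincomb t Δ)  ≡⟨ expansion x t ⟩
          ∑ᴸ (allIdx q k) (λ α → eval (coefficient α) x * monomial α t)
            ≡⟨ ∑ᴸ-zero (All.universal (λ α → trans (cong (_* monomial α t) (c≡0 α)) (zeroˡ _)) (allIdx q k)) ⟩
          0#                        ∎
          where open ≡-Reasoning

module _ {q : ℕ} (F : FiniteField q) where
  open FiniteField F using (0#; 1#; 0≢1; enum; enum-surj)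

  size≥2 : 2 ≤ q
  size≥2 with enum-surj 0# | enum-surj 1#
  ... | i , enumᵢ≡0 | j , enumⱼ≡1 = distinct⇒2≤ i j
    (λ i≡j → 0≢1 (trans (sym enumᵢ≡0) (trans (cong enum i≡j) enumⱼ≡1)))
    where
    distinct⇒2≤ : ∀ {m} (i j : Fin m) → ¬ i ≡ j → 2 ≤ m
    distinct⇒2≤ {suc zero}    fz fz i≢j = contradiction refl i≢j
    distinct⇒2≤ {suc (suc _)} _  _  _   = s≤s (s≤s z≤n)

lemma3p1 : (q : ℕ) → IsPrimePower q → (F : FiniteField q) →
    let open FiniteField F in
    let open FF F in
    (n k : ℕ) (f : Point n → Carrier) (Δ : Fin k → Point n) →
    LinearlyIndependent Δ →
    (d : ℕ) → Σ (Poly n) (λ P → DegLe P d × (∀ x → eval P x ≡ f x)) →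
    Σ ((Fin k → Fin q) → Poly n) λ fα →
      (∀ α → DegLeMinus (fα α) d (wt α)) ×
      (∀ x → ((∀ u → InSpan Δ u → f (x ⊕ u) ≡ 0#) ⇔ (∀ α → eval (fα α) x ≡ 0#)))
lemma3p1 zero          _ F = contradiction (size≥2 F) λ ()
lemma3p1 (suc zero)    _ F = contradiction (size≥2 F) λ { (s≤s ()) }
lemma3p1 (suc (suc r)) _ F n k f Δ _ d (P , P-deg , P≗f) =
    coefficient Δ P d P-deg
  , coefficient-degree Δ P d P-deg
  , coset-vanishing⇔coefficients-vanish Δ P d P-deg f P≗f
  where open Expansion r F
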